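{- For every $\sigma\in A^s$ and every $\sigma$-normal form $P_\sigma$: $\mathrm{EqMFEL}\vdash P_\sigma\mathbin{\wedge_\bullet}\mathsf F=\mathsf F_\sigma$ and $\mathrm{EqMFEL}\vdash P_\sigma\mathbin{\vee_\bullet}\mathsf T=\mathsf T_\sigma$.
   Context: $A$ is a countable set of atoms; $A^s$ is the set of finite strings over $A$ with no atom occurring more than once. Terms are built from $\mathsf T,\mathsf F$, atoms, $\neg$, $\mathbin{\wedge_\bullet}$, $\mathbin{\vee_\bullet}$. $\sigma$-normal forms: for $\sigma=\epsilon$ they are $\mathsf T$ and $\mathsf F$; for $\sigma=a\rho$ ($a\in A$) they are the terms $(a\mathbin{\wedge_\bullet}P_1)\mathbin{\vee_\bullet}(\neg a\mathbin{\wedge_\bullet}P_2)$ with $P_1,P_2$ $\rho$-normal forms. $\mathsf T_\epsilon=\mathsf T$, $\mathsf T_{a\rho}=(a\mathbin{\wedge_\bullet}\mathsf T_\rho)\mathbin{\vee_\bullet}(\neg a\mathbin{\wedge_\bullet}\mathsf T_\rho)$; $\mathsf F_\epsilon=\mathsf F$, $\mathsf F_{a\rho}=(a\mathbin{\wedge_\bullet}\mathsf F_\rho)\mathbin{\vee_\bullet}(\neg a\mathbin{\wedge_\bullet}\mathsf F_\rho)$. $\mathrm{EqMFEL}$ consists of: $\mathsf F=\neg\mathsf T$; $x\mathbin{\vee_\bullet}y=\neg(\neg x\mathbin{\wedge_\bullet}\neg y)$; $\neg\neg x=x$; $(x\mathbin{\wedge_\bullet}y)\mathbin{\wedge_\bullet}z=x\mathbin{\wedge_\bullet}(y\mathbin{\wedge_\bullet}z)$;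 $\mathsf T\mathbin{\wedge_\bullet}x=x$; $x\mathbin{\wedge_\bullet}\mathsf T=x$; $x\mathbin{\wedge_\bullet}\mathsf F=\mathsf F\mathbin{\wedge_\bullet}x$; $\neg x\mathbin{\wedge_\bullet}\mathsf F=x\mathbin{\wedge_\bullet}\mathsf F$; $(x\mathbin{\wedge_\bullet}\mathsf F)\mathbin{\vee_\bullet}y=(x\mathbin{\vee_\bullet}\mathsf T)\mathbin{\wedge_\bullet}y$; $x\mathbin{\vee_\bullet}(y\mathbin{\wedge_\bullet}\mathsf F)=x\mathbin{\wedge_\bullet}(y\mathbin{\vee_\bullet}\mathsf T)$; $(x\mathbin{\vee_\bullet}y)\mathbin{\wedge_\bullet}z=(\neg x\mathbin{\wedge_\bullet}(y\mathbin{\wedge_\bullet}z))\mathbin{\vee_\bullet}(x\mathbin{\wedge_\bullet}z)$. $\vdash$ is derivability in equational logic. -}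

module Defs where

open import Data.Nat using (ℕ)
open import Data.List using (List; []; _∷_)
open import Data.List.Relation.Unary.Unique.Propositional using (Unique)

Atom : Set
Atom = ℕ

-- Terms over atoms; `var` provides the equational-logic variables
-- used in the axioms of EqMFEL.
infixr 6 _∧•_
infixr 5 _∨•_
data Term : Set where
  T F  : Term
  atom : Atom → Term
  var  : ℕ → Term
  ¬_   : Term → Term
  _∧•_ : Term → Term → Term
  _∨•_ : Term → Term → Term

As : Set
As = List Atom

InAs : As → Set
InAs σ = Unique σ

data NF : As → Term → Set where
  nf-T : NF [] T
  nf-F : NF [] F
  nf-cons : ∀ {ρ P₁ P₂} (a : Atom) → NF ρ P₁ → NF ρ P₂ →
            NF (a ∷ ρ) ((atom a ∧• P₁) ∨• ((¬ atom a) ∧• P₂))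

T_ : As → Term
T_ [] = T
T_ (a ∷ ρ) = (atom a ∧• T_ ρ) ∨• ((¬ atom a) ∧• T_ ρ)

F_ : As → Term
F_ [] = F
F_ (a ∷ ρ) = (atom a ∧• F_ ρ) ∨• ((¬ atom a) ∧• F_ ρ)

-- Derivability in equational logic from EqMFEL.  Axioms are given as
-- schemes over all terms (= closure under substitution instances).
infix 4 EqMFEL⊢_≈_
data EqMFEL⊢_≈_ : Term → Term → Set where
  refl  : ∀ {t} → EqMFEL⊢ t ≈ t
  sym   : ∀ {t u} → EqMFEL⊢ t ≈ u → EqMFEL⊢ u ≈ t
  trans : ∀ {t u v} → EqMFEL⊢ t ≈ u → EqMFEL⊢ u ≈ v → EqMFEL⊢ t ≈ v
  cong¬ : ∀ {t u} → EqMFEL⊢ t ≈ u → EqMFEL⊢ ¬ t ≈ ¬ u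
  cong∧ : ∀ {t t' u u'} → EqMFEL⊢ t ≈ t' → EqMFEL⊢ u ≈ u' →
          EqMFEL⊢ t ∧• u ≈ t' ∧• u'
  cong∨ : ∀ {t t' u u'} → EqMFEL⊢ t ≈ t' → EqMFEL⊢ u ≈ u' →
          EqMFEL⊢ t ∨• u ≈ t' ∨• u'
  ax1  : EqMFEL⊢ F ≈ ¬ T
  ax2  : ∀ x y → EqMFEL⊢ x ∨• y ≈ ¬ ((¬ x) ∧• (¬ y))
  ax3  : ∀ x → EqMFEL⊢ ¬ (¬ x) ≈ x
  ax4  : ∀ x y z → EqMFEL⊢ (x ∧• y) ∧• z ≈ x ∧• (y ∧• z)
  ax5  : ∀ x → EqMFEL⊢ T ∧• x ≈ x
  ax6  : ∀ x → EqMFEL⊢ x ∧• T ≈ x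
  ax7  : ∀ x → EqMFEL⊢ x ∧• F ≈ F ∧• x
  ax8  : ∀ x → EqMFEL⊢ (¬ x) ∧• F ≈ x ∧• F
  ax9  : ∀ x y → EqMFEL⊢ (x ∧• F) ∨• y ≈ (x ∨• T) ∧• y
  ax10 : ∀ x y → EqMFEL⊢ x ∨• (y ∧• F) ≈ x ∧• (y ∨• T)
  ax11 : ∀ x y z → EqMFEL⊢ (x ∨• y) ∧• z ≈ ((¬ x) ∧• (y ∧• z)) ∨• (x ∧• z)

-- Everything rests on the fact that x ∧• F and x ∨• T only record whether
-- evaluating x terminates: x ∨• T ≈ ¬ (x ∧• F), and a negation in front of
-- a term followed by a failing sequel can be added or dropped.  Hence a
-- conditional (c ∧• P₁) ∨• (¬ c ∧• P₂) followed by F no longer depends on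
-- which branch is taken, so it collapses branch by branch to F_σ by
-- induction on the normal form; the T-case follows by negating, using
-- ¬ F_σ ≈ T_σ.
module Submission where

open import Defs
open import Data.List using ([]; _∷_)
open import Data.Product using (_×_; _,_)
open import Relation.Binary.Bundles using (Setoid)

EqMFEL-setoid : Setoid _ _
EqMFEL-setoid = record
  { Carrier       = Term
  ; _≈_           = EqMFEL⊢_≈_
  ; isEquivalence = record { refl = refl ; sym = sym ; trans = trans }
  }

open import Relation.Binary.Reasoning.Setoid EqMFEL-setoid

∨T≈¬∧F : ∀ x → EqMFEL⊢ x ∨• T ≈ ¬ (x ∧• F)
∨T≈¬∧F x = begin
  x ∨• T                 ≈⟨ ax2 x T ⟩
  ¬ ((¬ x) ∧• (¬ T))     ≈⟨ cong¬ (cong∧ refl (sym ax1)) ⟩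
  ¬ ((¬ x) ∧• F)         ≈⟨ cong¬ (ax8 x) ⟩
  ¬ (x ∧• F)             ∎

¬F≈T : EqMFEL⊢ ¬ F ≈ T
¬F≈T = trans (cong¬ ax1) (ax3 T)

¬-∧∧F : ∀ p q → EqMFEL⊢ p ∧• (q ∧• F) ≈ (¬ p) ∧• (q ∧• F)
¬-∧∧F p q = begin
  p ∧• (q ∧• F)          ≈⟨ cong∧ refl (ax7 q) ⟩
  p ∧• (F ∧• q)          ≈⟨ sym (ax4 p F q) ⟩
  (p ∧• F) ∧• q          ≈⟨ cong∧ (sym (ax8 p)) refl ⟩
  ((¬ p) ∧• F) ∧• q      ≈⟨ ax4 (¬ p) F q ⟩
  (¬ p) ∧• (F ∧• q)      ≈⟨ cong∧ refl (sym (ax7 q)) ⟩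
  (¬ p) ∧• (q ∧• F)      ∎

∨-∧F : ∀ x y → EqMFEL⊢ (x ∨• y) ∧• F ≈ (¬ x) ∧• (y ∧• F)
∨-∧F x y = begin
  (x ∨• y) ∧• F                  ≈⟨ cong∧ (ax2 x y) refl ⟩
  ¬ ((¬ x) ∧• (¬ y)) ∧• F        ≈⟨ ax8 _ ⟩
  ((¬ x) ∧• (¬ y)) ∧• F          ≈⟨ ax4 _ _ _ ⟩
  (¬ x) ∧• ((¬ y) ∧• F)          ≈⟨ cong∧ refl (ax8 y) ⟩
  (¬ x) ∧• (y ∧• F)              ∎

F∧[∨T]≈∧F : ∀ w → EqMFEL⊢ F ∧• (w ∨• T) ≈ w ∧• F
F∧[∨T]≈∧F w = begin
  F ∧• (w ∨• T)          ≈⟨ sym (ax7 (w ∨• T)) ⟩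
  (w ∨• T) ∧• F          ≈⟨ ∨-∧F w T ⟩
  (¬ w) ∧• (T ∧• F)      ≈⟨ cong∧ refl (ax5 F) ⟩
  (¬ w) ∧• F             ≈⟨ ax8 w ⟩
  w ∧• F                 ∎

same-branches : ∀ c t →
  EqMFEL⊢ (c ∧• t) ∨• ((¬ c) ∧• t) ≈ ¬ (c ∧• F) ∧• t
same-branches c t = begin
  (c ∧• t) ∨• ((¬ c) ∧• t)               ≈⟨ cong∨ (cong∧ (sym (ax3 c)) (sym (ax5 t))) refl ⟩
  (¬ (¬ c) ∧• (T ∧• t)) ∨• ((¬ c) ∧• t)  ≈⟨ sym (ax11 (¬ c) T t) ⟩
  ((¬ c) ∨• T) ∧• t                      ≈⟨ cong∧ (∨T≈¬∧F (¬ c)) refl ⟩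
  ¬ ((¬ c) ∧• F) ∧• t                    ≈⟨ cong∧ (cong¬ (ax8 c)) refl ⟩
  ¬ (c ∧• F) ∧• t                        ∎

conditional-∧F : ∀ c P₁ P₂ G →
  EqMFEL⊢ P₁ ∧• F ≈ G → EqMFEL⊢ P₂ ∧• F ≈ G →
  EqMFEL⊢ ((c ∧• P₁) ∨• ((¬ c) ∧• P₂)) ∧• F ≈ (c ∧• G) ∨• ((¬ c) ∧• G)
conditional-∧F c P₁ P₂ G P₁∧F≈G P₂∧F≈G = begin
  ((c ∧• P₁) ∨• W) ∧• F               ≈⟨ ∨-∧F (c ∧• P₁) W ⟩
  ¬ (c ∧• P₁) ∧• (W ∧• F)             ≈⟨ sym (¬-∧∧F (c ∧• P₁) W) ⟩
  (c ∧• P₁) ∧• (W ∧• F)               ≈⟨ ax4 c P₁ (W ∧• F) ⟩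
  c ∧• (P₁ ∧• (W ∧• F))               ≈⟨ cong∧ refl (cong∧ refl (sym (F∧[∨T]≈∧F W))) ⟩
  c ∧• (P₁ ∧• (F ∧• (W ∨• T)))        ≈⟨ cong∧ refl (sym (ax4 P₁ F (W ∨• T))) ⟩
  c ∧• ((P₁ ∧• F) ∧• (W ∨• T))        ≈⟨ sym (ax4 c (P₁ ∧• F) (W ∨• T)) ⟩
  (c ∧• (P₁ ∧• F)) ∧• (W ∨• T)        ≈⟨ sym (ax10 (c ∧• (P₁ ∧• F)) W) ⟩
  (c ∧• (P₁ ∧• F)) ∨• (W ∧• F)        ≈⟨ cong∨ refl (ax4 (¬ c) P₂ F) ⟩
  (c ∧• (P₁ ∧• F)) ∨• ((¬ c) ∧• (P₂ ∧• F))
                                      ≈⟨ cong∨ (cong∧ refl P₁∧F≈G) (cong∧ refl P₂∧F≈G) ⟩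
  (c ∧• G) ∨• ((¬ c) ∧• G)            ∎
  where
  W : Term
  W = (¬ c) ∧• P₂

¬Fσ≈Tσ : ∀ σ → EqMFEL⊢ ¬ (F_ σ) ≈ T_ σ
¬Fσ≈Tσ [] = ¬F≈T
¬Fσ≈Tσ (a ∷ ρ) = begin
  ¬ ((c ∧• F_ ρ) ∨• ((¬ c) ∧• F_ ρ))  ≈⟨ cong¬ (same-branches c (F_ ρ)) ⟩
  ¬ (¬ (c ∧• F) ∧• F_ ρ)              ≈⟨ cong¬ (cong∧ refl (sym (ax3 (F_ ρ)))) ⟩
  ¬ (¬ (c ∧• F) ∧• ¬ (¬ (F_ ρ)))      ≈⟨ sym (ax2 (c ∧• F) (¬ F_ ρ)) ⟩
  (c ∧• F) ∨• ¬ (F_ ρ)                ≈⟨ ax9 c (¬ F_ ρ) ⟩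
  (c ∨• T) ∧• ¬ (F_ ρ)                ≈⟨ cong∧ (∨T≈¬∧F c) (¬Fσ≈Tσ ρ) ⟩
  ¬ (c ∧• F) ∧• T_ ρ                  ≈⟨ sym (same-branches c (T_ ρ)) ⟩
  (c ∧• T_ ρ) ∨• ((¬ c) ∧• T_ ρ)      ∎
  where
  c : Term
  c = atom a

nf-∧F≈Fσ : ∀ {σ P} → NF σ P → EqMFEL⊢ P ∧• F ≈ F_ σ
nf-∧F≈Fσ nf-T = ax5 F
nf-∧F≈Fσ nf-F = trans (cong∧ ax1 refl) (trans (ax8 T) (ax5 F))
nf-∧F≈Fσ (nf-cons a P₁ P₂) =
  conditional-∧F (atom a) _ _ _ (nf-∧F≈Fσ P₁) (nf-∧F≈Fσ P₂)

nf-∨T≈Tσ : ∀ {σ P} → NF σ P → EqMFEL⊢ P ∨• T ≈ T_ σ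
nf-∨T≈Tσ {σ} {P} nf = begin
  P ∨• T         ≈⟨ ∨T≈¬∧F P ⟩
  ¬ (P ∧• F)     ≈⟨ cong¬ (nf-∧F≈Fσ nf) ⟩
  ¬ (F_ σ)       ≈⟨ ¬Fσ≈Tσ σ ⟩
  T_ σ           ∎

lemma4p14 : (σ : As) → InAs σ → (P : Term) → NF σ P →
    (EqMFEL⊢ P ∧• F ≈ F_ σ) × (EqMFEL⊢ P ∨• T ≈ T_ σ)
lemma4p14 σ _ P nf = nf-∧F≈Fσ nf , nf-∨T≈Tσ nf
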